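{- Let $N$ be a network on $n$ leaves. Then $B(N)$ has a cherry cover consisting only of cherry shapes if and only if $N$ is a tree. Furthermore, if $N$ is a tree, then there exists a cherry cover of $N$ containing exactly $n-1$ cherry shapes.
   Context: A (phylogenetic) network $N$ on a finite set $X$ is a directed acyclic graph with a unique vertex of indegree $0$ and outdegree $1$ (the root), vertices of indegree $1$ and outdegree $0$ (the leaves) bijectively labelled by $X$, and in which every other vertex has either indegree $1$ (a tree vertex) or outdegree $1$ (a reticulation), but not both. The edge leaving the root is the root edge. A tree is a network with no reticulations. The bulged version $B(N)$ is the multigraph obtained from $N$ by replacing the outgoing edge of each reticulation of indegree $k$ by $k-1$ parallel edges (so $B(N)=N$ when $N$ is a tree); in $B(N)$ a reticulation is a vertex of indegree at least $2$ and outdegree at least $1$. A cherry shape is a subgraph of $B(N)$ on three distinct vertices $x,y,p$ with edges $px$ and $py$. A reticulated cherry shape is a subgraph of $B(N)$ on four vertices $x,y,p_x,p_y$ with edges $p_xx$, $p_yp_x$, $p_yy$, where $p_x$ is a reticulation; $p_yp_x$ is its middle edge. An edge is covered by a shape if it is one of its edges. A cherry cover of $B(N)$ is a set $P$ of cherry shapes and reticulated cherry shapes such that: (i) every edge other than the root edge is covered by at least one shape in $P$; (ii) every outgoing edge of a reticulation is covered by exactly one shape in $P$; (iii) every edge that is the middle edge of some reticulated cherry shape in $P$ is covered by exactly one shape in $P$. -}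

module Defs where

open import Data.Nat using (ℕ; suc; _⊔_; pred)
open import Data.Unit using (⊤)
open import Data.Empty using (⊥)
open import Data.Fin using (Fin)
open import Data.Fin.Properties using (_≟_)
open import Data.List using (List; []; _∷_; length; filter; allFin)
open import Data.List.Membership.Propositional using (_∈_)
open import Data.List.Relation.Unary.All using (All)
open import Data.List.Relation.Unary.AllPairs using (AllPairs)
open import Data.Product using (Σ; ∃; _×_; _,_; proj₁; proj₂)
open import Data.Sum using (_⊎_)
open import Relation.Binary.PropositionalEquality using (_≡_; _≢_)
open import Relation.Nullary using (¬_)
open import Function.Bundles using (_⇔_)

record Digraph : Set where
  field
    V   : ℕ
    E   : ℕ
    src : Fin E → Fin V
    tgt : Fin E → Fin V

  indeg : Fin V → ℕ
  indeg v = length (filter (λ e → tgt e ≟ v) (allFin E))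

  outdeg : Fin V → ℕ
  outdeg v = length (filter (λ e → src e ≟ v) (allFin E))

  data Reach⁺ : Fin V → Fin V → Set where
    step : ∀ e → Reach⁺ (src e) (tgt e)
    cons : ∀ e {w} → Reach⁺ (tgt e) w → Reach⁺ (src e) w

  Acyclic : Set
  Acyclic = ∀ v → ¬ Reach⁺ v v

  Simple : Set
  Simple = ∀ e f → src e ≡ src f → tgt e ≡ tgt f → e ≡ f

record Network (n : ℕ) : Set where
  field
    G    : Digraph
  open Digraph G public
  field
    root : Fin V
    leaf : Fin n → Fin V
    simple  : Simple
    acyclic : Acyclic
    root-indeg  : indeg root ≡ 0
    root-outdeg : outdeg root ≡ 1
    root-unique : ∀ v → indeg v ≡ 0 → v ≡ root
    leaf-injective : ∀ x y → leaf x ≡ leaf y → x ≡ y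
    leaf-degrees   : ∀ x → indeg (leaf x) ≡ 1 × outdeg (leaf x) ≡ 0
    leaf-complete  : ∀ v → indeg v ≡ 1 → outdeg v ≡ 0 → ∃ λ x → leaf x ≡ v
    other : ∀ v → v ≢ root → (∀ x → leaf x ≢ v) →
            (indeg v ≡ 1 × outdeg v ≢ 1) ⊎ (indeg v ≢ 1 × outdeg v ≡ 1)

  Reticulation : Fin V → Set
  Reticulation v = v ≢ root × (∀ x → leaf x ≢ v) × indeg v ≢ 1 × outdeg v ≡ 1

  IsTree : Set
  IsTree = ∀ v → ¬ Reticulation v

  -- The bulged version B(N).  Vertices are those of N.  Each edge e of N
  -- is replaced by  mult e  parallel copies, where mult e = k - 1 if the
  -- source of e is a reticulation of indegree k (k ≥ 2), and 1 otherwise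
  -- (in a network, non-reticulations have indegree 0 or 1).

  mult : Fin E → ℕ
  mult e = pred (indeg (src e)) ⊔ 1

  BEdge : Set
  BEdge = Σ (Fin E) (λ e → Fin (mult e))

  bsrc : BEdge → Fin V
  bsrc b = src (proj₁ b)

  btgt : BEdge → Fin V
  btgt b = tgt (proj₁ b)

  BReticulation : Fin V → Set
  BReticulation v =
    (Σ BEdge λ a → Σ BEdge λ b → a ≢ b × btgt a ≡ v × btgt b ≡ v)
    × (Σ BEdge λ c → bsrc c ≡ v)

  RootEdge : BEdge → Set
  RootEdge b = bsrc b ≡ root

  record CherryShape : Set where
    field
      x y p : Fin V
      x≢y : x ≢ y
      x≢p : x ≢ p
      y≢p : y ≢ p
      e₁ e₂ : BEdge
      e₁-src : bsrc e₁ ≡ p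
      e₁-tgt : btgt e₁ ≡ x
      e₂-src : bsrc e₂ ≡ p
      e₂-tgt : btgt e₂ ≡ y

  record RetCherryShape : Set where
    field
      x y px py : Fin V
      x≢y   : x ≢ y
      x≢px  : x ≢ px
      x≢py  : x ≢ py
      y≢px  : y ≢ px
      y≢py  : y ≢ py
      px≢py : px ≢ py
      ex mid ey : BEdge
      ex-src  : bsrc ex ≡ px
      ex-tgt  : btgt ex ≡ x
      mid-src : bsrc mid ≡ py
      mid-tgt : btgt mid ≡ px
      ey-src  : bsrc ey ≡ py
      ey-tgt  : btgt ey ≡ y
      px-ret  : BReticulation px

  data Shape : Set where
    cherry    : CherryShape → Shape
    retCherry : RetCherryShape → Shape

  IsCherry : Shape → Set
  IsCherry (cherry _)    = ⊤
  IsCherry (retCherry _) = ⊥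

  Covers : Shape → BEdge → Set
  Covers (cherry c) b =
    b ≡ CherryShape.e₁ c ⊎ b ≡ CherryShape.e₂ c
  Covers (retCherry r) b =
    b ≡ RetCherryShape.ex r ⊎ b ≡ RetCherryShape.mid r ⊎ b ≡ RetCherryShape.ey r

  -- two shapes are the same subgraph iff they have the same edges
  -- (their vertices are exactly the endpoints of their edges)
  SameShape : Shape → Shape → Set
  SameShape s t = ∀ b → Covers s b ⇔ Covers t b

  MiddleEdge : Shape → BEdge → Set
  MiddleEdge (cherry _)    b = ⊥
  MiddleEdge (retCherry r) b = b ≡ RetCherryShape.mid r

  CoveredIn : List Shape → BEdge → Set
  CoveredIn P b = Σ Shape λ s → s ∈ P × Covers s b

  CoveredOnceIn : List Shape → BEdge → Set
  CoveredOnceIn P b =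
    CoveredIn P b ×
    (∀ s t → s ∈ P → t ∈ P → Covers s b → Covers t b → SameShape s t)

  -- A cherry cover: a set P of shapes (a duplicate-free list, shapes
  -- compared as subgraphs) satisfying (i), (ii), (iii).
  record CherryCover (P : List Shape) : Set where
    field
      distinct : AllPairs (λ s t → ¬ SameShape s t) P
      cover-i   : ∀ b → ¬ RootEdge b → CoveredIn P b
      cover-ii  : ∀ b → BReticulation (bsrc b) → CoveredOnceIn P b
      cover-iii : ∀ b → (Σ Shape λ s → s ∈ P × MiddleEdge s b) →
                  CoveredOnceIn P b

  numCherries : List Shape → ℕ
  numCherries [] = 0
  numCherries (cherry _ ∷ P)    = suc (numCherries P)
  numCherries (retCherry _ ∷ P) = numCherries P

module Submission where

-- (⇒) The two edges of a cherry shape leave its apex and have distinct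
-- heads, so the apex has outdegree ≥ 2 in N.  The edge leaving a
-- reticulation v is not the root edge, hence is covered by a cherry shape,
-- whose apex must be v; but v has outdegree 1.
--
-- (⇐ and the count) For every vertex p whose outgoing edges are f, e₂, …, e_k
-- (in a fixed order) take the cherry shapes (f, eᵢ), 2 ≤ i ≤ k.  In any
-- network these "fans" are pairwise different cherry shapes (shapes at
-- different vertices have different apexes) covering every edge that leaves
-- a vertex of outdegree ≥ 2.  In a tree every non-root vertex has indegree 1
-- and every non-root non-leaf vertex has outdegree ≥ 2, so B(N) = N, there
-- are no reticulations, (ii) and (iii) are vacuous, and the fans form a
-- cherry cover with Σₚ (outdeg p - 1) shapes.  Double counting (Σ indeg =
-- Σ outdeg = E, E + 1 = V in a tree, Σₚ (outdeg p - 1) + V = E + n) shows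
-- this number is n - 1.

open import Defs
open import Data.Bool using (true; false; if_then_else_)
open import Data.Empty using (⊥; ⊥-elim)
open import Data.Fin using (Fin; zero; suc; fromℕ<)
open import Data.Fin.Properties using (_≟_)
open import Data.List using (List; []; _∷_; _++_; length; filter; allFin; tabulate; concat)
open import Data.List.Membership.Propositional using (_∈_)
open import Data.List.Membership.Propositional.Properties using (∈-allFin; ∈-filter⁺; ∈-concat⁺′; ∈-tabulate⁺)
open import Data.List.Properties using (length-tabulate; filter-accept; filter-reject; filter-none)
open import Data.List.Relation.Unary.All as All using (All; []; _∷_)
import Data.List.Relation.Unary.All.Properties as All
open import Data.List.Relation.Unary.AllPairs using (AllPairs; []; _∷_)
import Data.List.Relation.Unary.AllPairs.Properties as AllPairs
open import Data.List.Relation.Unary.Any using (here; there)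
open import Data.List.Relation.Unary.Unique.Propositional using (Unique)
open import Data.List.Relation.Unary.Unique.Propositional.Properties using (allFin⁺; filter⁺)
open import Data.Nat using (ℕ; zero; suc; _+_; _∸_; _≤_; _<_; s≤s; z≤n; pred)
open import Data.Nat.Properties
  using (+-0-commutativeMonoid; +-assoc; +-comm; +-identityʳ; +-cancelˡ-≡; m+n∸n≡m;
         ≤-trans; ≤∧≢⇒<; <-irrefl; m≤n⇒m⊔n≡n; m≤n⇒m≤1+n; pred-mono-≤; m≤n⊔m)
  renaming (_≟_ to _≟ℕ_)
open import Data.Product using (Σ; _×_; _,_; proj₁; proj₂)
open import Data.Sum using (inj₁; inj₂)
open import Data.Unit using (tt)
open import Function using (_∘_; id)
open import Function.Bundles using (_⇔_; mk⇔; Equivalence)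
open import Relation.Binary.PropositionalEquality
  using (_≡_; _≢_; refl; sym; trans; cong; cong₂; subst; module ≡-Reasoning)
open import Relation.Nullary using (¬_; yes; no; does)
open import Relation.Unary using (Pred; Decidable)
open import Algebra.Properties.CommutativeMonoid.Sum +-0-commutativeMonoid
  using (sum-syntax; sum-cong-≗; ∑-distrib-+; sum-replicate-zero)

open ≡-Reasoning

δ : ∀ {m} → Fin m → Fin m → ℕ
δ u v = if does (u ≟ v) then 1 else 0

∑-δ : ∀ {m} (u : Fin m) → ∑[ v < m ] δ u v ≡ 1
∑-δ {suc m} zero    = cong suc (sum-replicate-zero m)
∑-δ {suc m} (suc u) = ∑-δ u

∑-one : ∀ m → ∑[ v < m ] 1 ≡ m
∑-one zero    = refl
∑-one (suc m) = cong suc (∑-one m)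

fibre : ∀ {A : Set} {m} → (A → Fin m) → Fin m → List A → ℕ
fibre f v L = length (filter (λ x → f x ≟ v) L)

fibre-cons : ∀ {A : Set} {m} (f : A → Fin m) v x L →
             fibre f v (x ∷ L) ≡ δ (f x) v + fibre f v L
fibre-cons f v x L with does (f x ≟ v)
... | true  = refl
... | false = refl

∑-fibres : ∀ {A : Set} {m} (f : A → Fin m) (L : List A) →
           ∑[ v < m ] fibre f v L ≡ length L
∑-fibres {m = m} f []      = sum-replicate-zero m
∑-fibres {m = m} f (x ∷ L) = begin
  ∑[ v < m ] fibre f v (x ∷ L)                  ≡⟨ sum-cong-≗ (λ v → fibre-cons f v x L) ⟩
  ∑[ v < m ] (δ (f x) v + fibre f v L)          ≡⟨ ∑-distrib-+ (δ (f x)) (λ v → fibre f v L) ⟩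
  ∑[ v < m ] δ (f x) v + ∑[ v < m ] fibre f v L ≡⟨ cong₂ _+_ (∑-δ (f x)) (∑-fibres f L) ⟩
  suc (length L)                                ∎

∈⇒nonempty : ∀ {A : Set} {x : A} {L} → x ∈ L → 0 < length L
∈⇒nonempty {L = _ ∷ _} _ = s≤s z≤n

two-distinct : ∀ {A : Set} {x y : A} {L} → x ∈ L → y ∈ L → x ≢ y → 2 ≤ length L
two-distinct {L = _ ∷ []}    (here refl) (here refl) x≢y = ⊥-elim (x≢y refl)
two-distinct {L = _ ∷ _ ∷ _} _           _           _   = s≤s (s≤s z≤n)

filter-singleton : ∀ {A : Set} {p} {P : Pred A p} (P? : Decidable P) {x L} →
                   Unique L → x ∈ L → P x → (∀ {y} → P y → y ≡ x) →
                   length (filter P? L) ≡ 1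
filter-singleton P? {L = x ∷ L} (x∉L ∷ _) (here refl) Px only = begin
  length (filter P? (x ∷ L)) ≡⟨ cong length (filter-accept P? Px) ⟩
  suc (length (filter P? L)) ≡⟨ cong (suc ∘ length) (filter-none P? (All.map (λ x≢z Pz → x≢z (sym (only Pz))) x∉L)) ⟩
  1                          ∎
filter-singleton P? {L = y ∷ L} (y∉L ∷ u) (there x∈L) Px only = begin
  length (filter P? (y ∷ L)) ≡⟨ cong length (filter-reject P? (λ Py → All.lookup y∉L x∈L (only Py))) ⟩
  length (filter P? L)       ≡⟨ filter-singleton P? u x∈L Px only ⟩
  1                          ∎

Fin-unique : ∀ {m} → m ≡ 1 → (i j : Fin m) → i ≡ j
Fin-unique refl zero zero = refl

module _ {n : ℕ} (N : Network n) where
  open Network N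

  outEdges inEdges : Fin V → List (Fin E)
  outEdges v = filter (λ e → src e ≟ v) (allFin E)
  inEdges  v = filter (λ e → tgt e ≟ v) (allFin E)

  ∈-outEdges : ∀ {e v} → src e ≡ v → e ∈ outEdges v
  ∈-outEdges {e} {v} = ∈-filter⁺ (λ e → src e ≟ v) (∈-allFin e)

  ∈-inEdges : ∀ {e v} → tgt e ≡ v → e ∈ inEdges v
  ∈-inEdges {e} {v} = ∈-filter⁺ (λ e → tgt e ≟ v) (∈-allFin e)

  outEdges-src : ∀ v → All (λ e → src e ≡ v) (outEdges v)
  outEdges-src v = All.all-filter (λ e → src e ≟ v) (allFin E)

  outEdges-unique : ∀ v → Unique (outEdges v)
  outEdges-unique v = filter⁺ (λ e → src e ≟ v) (allFin⁺ E)

  out-edge : ∀ v → 0 < outdeg v → Σ (Fin E) λ e → src e ≡ v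
  out-edge v = witness (outEdges-src v)
    where
    witness : ∀ {L} → All (λ e → src e ≡ v) L → 0 < length L → Σ (Fin E) λ e → src e ≡ v
    witness (src≡v ∷ _) _ = _ , src≡v

  no-loop : ∀ e → tgt e ≢ src e
  no-loop e eq = acyclic (src e) (subst (Reach⁺ (src e)) eq (step e))

  bE : Fin E → BEdge
  bE e = e , fromℕ< (m≤n⊔m (pred (indeg (src e))) 1)

  leafCount : Fin V → ℕ
  leafCount v = fibre leaf v (allFin n)

  -- Handshake counts: every edge has one head and one tail, every label
  -- one leaf.
  ∑-indeg : ∑[ v < V ] indeg v ≡ E
  ∑-indeg = trans (∑-fibres tgt (allFin E)) (length-tabulate id)

  ∑-outdeg : ∑[ v < V ] outdeg v ≡ E
  ∑-outdeg = trans (∑-fibres src (allFin E)) (length-tabulate id)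

  ∑-leafCount : ∑[ v < V ] leafCount v ≡ n
  ∑-leafCount = trans (∑-fibres leaf (allFin n)) (length-tabulate id)

  leafCount-leaf : ∀ x → leafCount (leaf x) ≡ 1
  leafCount-leaf x = filter-singleton (λ y → leaf y ≟ leaf x) (allFin⁺ n) (∈-allFin x) refl
                                      (λ {y} → leaf-injective y x)

  leafCount-nonleaf : ∀ v → (∀ x → leaf x ≢ v) → leafCount v ≡ 0
  leafCount-nonleaf v nonleaf =
    cong length (filter-none (λ y → leaf y ≟ v) {xs = allFin n} (All.tabulate (λ {y} _ → nonleaf y)))

  indeg≢1⇒nonleaf : ∀ v → indeg v ≢ 1 → ∀ x → leaf x ≢ v
  indeg≢1⇒nonleaf v indeg≢1 x refl = indeg≢1 (proj₁ (leaf-degrees x))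

  -- The tail of an edge is not a leaf, as leaves have outdegree 0.
  tail-nonleaf : ∀ e x → leaf x ≢ src e
  tail-nonleaf e x leaf≡src =
    <-irrefl (sym (proj₂ (leaf-degrees x))) (∈⇒nonempty (∈-outEdges {e} (sym leaf≡src)))

  numCherries-++ : ∀ P Q → numCherries (P ++ Q) ≡ numCherries P + numCherries Q
  numCherries-++ []                Q = refl
  numCherries-++ (cherry _ ∷ P)    Q = cong suc (numCherries-++ P Q)
  numCherries-++ (retCherry _ ∷ P) Q = numCherries-++ P Q

  cherry-edge-src : (c : CherryShape) → ∀ {b} → Covers (cherry c) b → bsrc b ≡ CherryShape.p c
  cherry-edge-src c (inj₁ refl) = CherryShape.e₁-src c
  cherry-edge-src c (inj₂ refl) = CherryShape.e₂-src c

  -- The two edges of a cherry shape have distinct heads, so they are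
  -- distinct edges of N leaving the apex.
  apex-outdeg : (c : CherryShape) → 2 ≤ outdeg (CherryShape.p c)
  apex-outdeg c = two-distinct (∈-outEdges e₁-src) (∈-outEdges e₂-src) different
    where
    open CherryShape c
    different : proj₁ e₁ ≢ proj₁ e₂
    different eq = x≢y (trans (sym e₁-tgt) (trans (cong tgt eq) e₂-tgt))

  CherryAt : Fin V → Shape → Set
  CherryAt p (cherry c)    = CherryShape.p c ≡ p
  CherryAt p (retCherry _) = ⊥

  CherryAt⇒IsCherry : ∀ {p} s → CherryAt p s → IsCherry s
  CherryAt⇒IsCherry (cherry _) _ = tt

  -- Cherry shapes with the same edges have the same apex: the first edge
  -- of s is an edge of t, and all edges of t leave the apex of t.
  sameShape-apex : ∀ {p q} s t → CherryAt p s → CherryAt q t → SameShape s t → p ≡ q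
  sameShape-apex (cherry c) (cherry d) refl refl same =
    trans (sym (cherry-edge-src c (inj₁ refl)))
          (cherry-edge-src d (Equivalence.to (same (CherryShape.e₁ c)) (inj₁ refl)))

  cherry-noMiddle : ∀ s b → IsCherry s → ¬ MiddleEdge s b
  cherry-noMiddle (cherry _) b _ ()

  -- (⇒) If cherry shapes alone cover B(N), then N has no reticulation: the
  -- edge leaving a reticulation v would be covered by a cherry shape with
  -- apex v, forcing outdeg v ≥ 2.
  cherryCover⇒tree : (Σ (List Shape) λ P → CherryCover P × All IsCherry P) → IsTree
  cherryCover⇒tree (P , cover , cherries) v (v≢root , _ , _ , outdeg≡1)
    with out-edge v (subst (0 <_) (sym outdeg≡1) (s≤s z≤n))
  ... | e , refl with CherryCover.cover-i cover (bE e) v≢root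
  ... | retCherry _ , s∈P , _      = All.lookup cherries s∈P
  ... | cherry c    , _   , covers =
    <-irrefl refl (subst (2 ≤_) outdeg≡1
      (subst (λ w → 2 ≤ outdeg w) (sym (cherry-edge-src c covers)) (apex-outdeg c)))

  -- The cherry shape formed by two different edges f, e with a common tail
  -- (their heads differ because N has no parallel edges).
  pairCherry : (f e : Fin E) → src e ≡ src f → f ≢ e → CherryShape
  pairCherry f e same f≢e = record
    { x = tgt f ; y = tgt e ; p = src f
    ; x≢y = λ heads → f≢e (simple f e (sym same) heads)
    ; x≢p = no-loop f
    ; y≢p = λ eq → no-loop e (trans eq (sym same))
    ; e₁ = bE f ; e₂ = bE e
    ; e₁-src = refl ; e₁-tgt = refl ; e₂-src = same ; e₂-tgt = refl }

  fan : (f : Fin E) (L : List (Fin E)) → All (λ e → src e ≡ src f) L → All (f ≢_) L → List Shape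
  fan f []      []       []       = []
  fan f (e ∷ L) (s ∷ ss) (d ∷ ds) = cherry (pairCherry f e s d) ∷ fan f L ss ds

  fan-count : ∀ f L ss ds → numCherries (fan f L ss ds) ≡ length L
  fan-count f []      []       []       = refl
  fan-count f (e ∷ L) (_ ∷ ss) (_ ∷ ds) = cong suc (fan-count f L ss ds)

  fan-apex : ∀ f L ss ds → All (CherryAt (src f)) (fan f L ss ds)
  fan-apex f []      []       []       = []
  fan-apex f (e ∷ L) (_ ∷ ss) (_ ∷ ds) = refl ∷ fan-apex f L ss ds

  -- A cherry shape whose second edge is neither f nor in L is not a shape
  -- of fan f L, since each shape of the fan has its edges among f ∷ L.
  fan-avoids : ∀ c f L ss ds → proj₁ (CherryShape.e₂ c) ≢ f → All (proj₁ (CherryShape.e₂ c) ≢_) L →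
               All (λ t → ¬ SameShape (cherry c) t) (fan f L ss ds)
  fan-avoids c f []      []       []       _  []          = []
  fan-avoids c f (e ∷ L) (s ∷ ss) (d ∷ ds) ≢f (≢e ∷ ≢L) = different ∷ fan-avoids c f L ss ds ≢f ≢L
    where
    different : ¬ SameShape (cherry c) (cherry (pairCherry f e s d))
    different same with Equivalence.to (same (CherryShape.e₂ c)) (inj₂ refl)
    ... | inj₁ eq = ≢f (cong proj₁ eq)
    ... | inj₂ eq = ≢e (cong proj₁ eq)

  fan-distinct : ∀ f L ss ds → Unique L → AllPairs (λ s t → ¬ SameShape s t) (fan f L ss ds)
  fan-distinct f []      []       []         []          = []
  fan-distinct f (e ∷ L) (s ∷ ss) (f≢e ∷ ds) (e∉L ∷ u) =
    fan-avoids (pairCherry f e s f≢e) f L ss ds (f≢e ∘ sym) e∉L ∷ fan-distinct f L ss ds u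

  fan-covers : ∀ f L ss ds {e} → e ∈ L → CoveredIn (fan f L ss ds) (bE e)
  fan-covers f (e ∷ L) (_ ∷ _)  (_ ∷ _)  (here refl) = _ , here refl , inj₂ refl
  fan-covers f (_ ∷ L) (_ ∷ ss) (_ ∷ ds) (there e∈L) with fan-covers f L ss ds e∈L
  ... | s , s∈fan , covers = s , there s∈fan , covers

  fan-covers-head : ∀ f L ss ds → 0 < length L → CoveredIn (fan f L ss ds) (bE f)
  fan-covers-head f (e ∷ L) (_ ∷ _) (_ ∷ _) _ = _ , here refl , inj₁ refl

  fanOf : ∀ {p} L → All (λ e → src e ≡ p) L → Unique L → List Shape
  fanOf []      _         _         = []
  fanOf (f ∷ L) (sf ∷ ss) (f∉L ∷ _) = fan f L (All.map (λ s → trans s (sym sf)) ss) f∉L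

  fanOf-count : ∀ {p} L ss u → numCherries (fanOf {p} L ss u) ≡ length L ∸ 1
  fanOf-count []      _        _         = refl
  fanOf-count (f ∷ L) (_ ∷ ss) (f∉L ∷ _) = fan-count f L _ f∉L

  fanOf-apex : ∀ {p} L ss u → All (CherryAt p) (fanOf {p} L ss u)
  fanOf-apex []      _         _         = []
  fanOf-apex (f ∷ L) (sf ∷ ss) (f∉L ∷ _) =
    subst (λ q → All (CherryAt q) (fan f L ss′ f∉L)) sf (fan-apex f L ss′ f∉L)
    where
    ss′ : All (λ e → src e ≡ src f) L
    ss′ = All.map (λ s → trans s (sym sf)) ss

  fanOf-distinct : ∀ {p} L ss u → AllPairs (λ s t → ¬ SameShape s t) (fanOf {p} L ss u)
  fanOf-distinct []      _        _           = []
  fanOf-distinct (f ∷ L) (_ ∷ ss) (f∉L ∷ u) = fan-distinct f L _ f∉L u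

  fanOf-covers : ∀ {p} L ss u {e} → e ∈ L → 2 ≤ length L → CoveredIn (fanOf {p} L ss u) (bE e)
  fanOf-covers (f ∷ L) (_ ∷ ss) (f∉L ∷ _) (here refl) (s≤s nonempty) = fan-covers-head f L _ f∉L nonempty
  fanOf-covers (f ∷ L) (_ ∷ ss) (f∉L ∷ _) (there e∈L) _              = fan-covers f L _ f∉L e∈L

  fansAt : Fin V → List Shape
  fansAt p = fanOf (outEdges p) (outEdges-src p) (outEdges-unique p)

  fanCover : List Shape
  fanCover = concat (tabulate fansAt)

  numCherries-concat : ∀ {m} (g : Fin m → List Shape) →
                       numCherries (concat (tabulate g)) ≡ ∑[ i < m ] numCherries (g i)
  numCherries-concat {zero}  g = refl
  numCherries-concat {suc m} g = begin
    numCherries (g zero ++ concat (tabulate (g ∘ suc)))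
      ≡⟨ numCherries-++ (g zero) (concat (tabulate (g ∘ suc))) ⟩
    numCherries (g zero) + numCherries (concat (tabulate (g ∘ suc)))
      ≡⟨ cong (numCherries (g zero) +_) (numCherries-concat (g ∘ suc)) ⟩
    numCherries (g zero) + ∑[ i < m ] numCherries (g (suc i))
      ∎

  fanCover-count : numCherries fanCover ≡ ∑[ p < V ] (outdeg p ∸ 1)
  fanCover-count = trans (numCherries-concat fansAt)
    (sum-cong-≗ λ p → fanOf-count (outEdges p) (outEdges-src p) (outEdges-unique p))

  fansAt-apex : ∀ p → All (CherryAt p) (fansAt p)
  fansAt-apex p = fanOf-apex (outEdges p) (outEdges-src p) (outEdges-unique p)

  fanCover-cherries : All IsCherry fanCover
  fanCover-cherries = All.concat⁺ (All.tabulate⁺ λ p → All.map (CherryAt⇒IsCherry _) (fansAt-apex p))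

  -- Fans at different vertices share no shape, because shapes at different
  -- vertices have different apexes.
  fanCover-distinct : AllPairs (λ s t → ¬ SameShape s t) fanCover
  fanCover-distinct = AllPairs.concat⁺
    (All.tabulate⁺ λ p → fanOf-distinct (outEdges p) (outEdges-src p) (outEdges-unique p))
    (AllPairs.tabulate⁺ apart)
    where
    apart : ∀ {p q} → p ≢ q → All (λ s → All (λ t → ¬ SameShape s t) (fansAt q)) (fansAt p)
    apart {p} {q} p≢q =
      All.map (λ {s} s-at-p → All.map (λ {t} t-at-q → p≢q ∘ sameShape-apex s t s-at-p t-at-q)
                                      (fansAt-apex q))
              (fansAt-apex p)

  fanCover-covers : ∀ e → 2 ≤ outdeg (src e) → CoveredIn fanCover (bE e)
  fanCover-covers e big
    with fanOf-covers (outEdges (src e)) (outEdges-src (src e)) (outEdges-unique (src e)) (∈-outEdges refl) big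
  ... | s , s∈fan , covers = s , ∈-concat⁺′ s∈fan (∈-tabulate⁺ (src e)) , covers

  module _ (tree : IsTree) where

    -- Every non-root vertex of a tree has indegree 1: otherwise it would
    -- have outdegree 1, i.e. be a reticulation.
    tree-indeg : ∀ v → v ≢ root → indeg v ≡ 1
    tree-indeg v v≢root with indeg v ≟ℕ 1
    ... | yes indeg≡1 = indeg≡1
    ... | no  indeg≢1 with other v v≢root (indeg≢1⇒nonleaf v indeg≢1)
    ...   | inj₁ (indeg≡1 , _) = ⊥-elim (indeg≢1 indeg≡1)
    ...   | inj₂ (_ , outdeg≡1)  =
      ⊥-elim (tree v (v≢root , indeg≢1⇒nonleaf v indeg≢1 , indeg≢1 , outdeg≡1))

    tree-indeg≤1 : ∀ v → indeg v ≤ 1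
    tree-indeg≤1 v with v ≟ root
    ... | yes refl   = subst (_≤ 1) (sym root-indeg) z≤n
    ... | no  v≢root = subst (_≤ 1) (sym (tree-indeg v v≢root)) (s≤s z≤n)

    -- The tail of a non-root edge of a tree has outdegree ≥ 2: it is not a
    -- leaf, and outdegree 1 would make it a reticulation.
    tree-outdeg : ∀ e → src e ≢ root → 2 ≤ outdeg (src e)
    tree-outdeg e src≢root with other (src e) src≢root (tail-nonleaf e)
    ... | inj₁ (_ , outdeg≢1) = ≤∧≢⇒< (∈⇒nonempty (∈-outEdges {e} refl)) (outdeg≢1 ∘ sym)
    ... | inj₂ (indeg≢1 , _)  = ⊥-elim (indeg≢1 (tree-indeg (src e) src≢root))

    -- B(N) = N for a tree: every edge has a single copy.
    tree-mult : ∀ e → mult e ≡ 1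
    tree-mult e = m≤n⇒m⊔n≡n (m≤n⇒m≤1+n (pred-mono-≤ (tree-indeg≤1 (src e))))

    tree-bE : (b : BEdge) → b ≡ bE (proj₁ b)
    tree-bE (e , i) = cong (e ,_) (Fin-unique (tree-mult e) i _)

    -- Hence B(N) has no reticulations: two different edges of B(N) entering
    -- v would be different edges of N, but indeg v ≤ 1.
    tree-noBReticulation : ∀ v → ¬ BReticulation v
    tree-noBReticulation v ((a , b , a≢b , a-tgt , b-tgt) , _) =
      <-irrefl refl (≤-trans (two-distinct (∈-inEdges a-tgt) (∈-inEdges b-tgt) different) (tree-indeg≤1 v))
      where
      different : proj₁ a ≢ proj₁ b
      different eq = a≢b (trans (tree-bE a) (trans (cong bE eq) (sym (tree-bE b))))

    -- A tree has one vertex more than edges: Σᵥ (indeg v + [v = root]) = V.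
    tree-edges : E + 1 ≡ V
    tree-edges = begin
      E + 1                                    ≡⟨ cong₂ _+_ (sym ∑-indeg) (sym (∑-δ root)) ⟩
      ∑[ v < V ] indeg v + ∑[ v < V ] δ root v ≡⟨ sym (∑-distrib-+ indeg (δ root)) ⟩
      ∑[ v < V ] (indeg v + δ root v)          ≡⟨ sum-cong-≗ indeg+δ ⟩
      ∑[ v < V ] 1                             ≡⟨ ∑-one V ⟩
      V                                        ∎
      where
      indeg+δ : ∀ v → indeg v + δ root v ≡ 1
      indeg+δ v with root ≟ v
      ... | yes refl   = cong (_+ 1) root-indeg
      ... | no  root≢v = cong (_+ 0) (tree-indeg v (root≢v ∘ sym))

    -- Each vertex satisfies (outdeg v - 1) + 1 = outdeg v + leafCount v:
    -- a vertex of outdegree 0 in a tree has indegree 1, hence is a leaf.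
    excess-leaf : ∀ v → (outdeg v ∸ 1) + 1 ≡ outdeg v + leafCount v
    excess-leaf v with outdeg v in outdeg≡
    ... | zero  = sym (subst (λ w → leafCount w ≡ 1) (proj₂ labelled) (leafCount-leaf (proj₁ labelled)))
      where
      v≢root : v ≢ root
      v≢root refl with () ← trans (sym root-outdeg) outdeg≡
      labelled : Σ (Fin n) λ x → leaf x ≡ v
      labelled = leaf-complete v (tree-indeg v v≢root) outdeg≡
    ... | suc k = begin
      k + 1               ≡⟨ +-comm k 1 ⟩
      suc k               ≡⟨ sym (+-identityʳ (suc k)) ⟩
      suc k + 0           ≡⟨ cong (suc k +_) (sym (leafCount-nonleaf v nonleaf)) ⟩
      suc k + leafCount v ∎
      where
      nonleaf : ∀ x → leaf x ≢ v
      nonleaf x refl with () ← trans (sym (proj₂ (leaf-degrees x))) outdeg≡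

    ∑-excess : ∑[ p < V ] (outdeg p ∸ 1) + V ≡ E + n
    ∑-excess = begin
      ∑[ p < V ] (outdeg p ∸ 1) + V                  ≡⟨ cong (∑[ p < V ] (outdeg p ∸ 1) +_) (sym (∑-one V)) ⟩
      ∑[ p < V ] (outdeg p ∸ 1) + ∑[ p < V ] 1       ≡⟨ sym (∑-distrib-+ (λ p → outdeg p ∸ 1) (λ _ → 1)) ⟩
      ∑[ p < V ] ((outdeg p ∸ 1) + 1)                ≡⟨ sum-cong-≗ excess-leaf ⟩
      ∑[ p < V ] (outdeg p + leafCount p)            ≡⟨ ∑-distrib-+ outdeg leafCount ⟩
      ∑[ p < V ] outdeg p + ∑[ p < V ] leafCount p   ≡⟨ cong₂ _+_ ∑-outdeg ∑-leafCount ⟩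
      E + n                                          ∎

    -- Σₚ (outdeg p - 1) = n - 1: substitute V = E + 1 and cancel E.
    tree-excess : ∑[ p < V ] (outdeg p ∸ 1) ≡ n ∸ 1
    tree-excess = trans (sym (m+n∸n≡m S 1)) (cong (_∸ 1) (+-cancelˡ-≡ E (S + 1) n (begin
      E + (S + 1)  ≡⟨ sym (+-assoc E S 1) ⟩
      E + S + 1    ≡⟨ cong (_+ 1) (+-comm E S) ⟩
      S + E + 1    ≡⟨ +-assoc S E 1 ⟩
      S + (E + 1)  ≡⟨ cong (S +_) tree-edges ⟩
      S + V        ≡⟨ ∑-excess ⟩
      E + n        ∎)))
      where
      S : ℕ
      S = ∑[ p < V ] (outdeg p ∸ 1)

    -- In a tree the fans form a cherry cover: every non-root edge leaves a
    -- vertex of outdegree ≥ 2, and (ii), (iii) are vacuous.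
    fanCover-isCherryCover : CherryCover fanCover
    fanCover-isCherryCover = record
      { distinct  = fanCover-distinct
      ; cover-i   = λ b notRoot → subst (CoveredIn fanCover) (sym (tree-bE b))
                                        (fanCover-covers (proj₁ b) (tree-outdeg (proj₁ b) notRoot))
      ; cover-ii  = λ b ret → ⊥-elim (tree-noBReticulation (bsrc b) ret)
      ; cover-iii = λ { b (s , s∈cover , middle) →
                        ⊥-elim (cherry-noMiddle s b (All.lookup fanCover-cherries s∈cover) middle) }
      }

mainTheorem6 : (n : ℕ) (N : Network n) →
    let open Network N in
    ((Σ (List Shape) λ P → CherryCover P × All IsCherry P) ⇔ IsTree)
    × (IsTree → Σ (List Shape) λ P → CherryCover P × numCherries P ≡ n ∸ 1)
mainTheorem6 n N =
  mk⇔ (cherryCover⇒tree N)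
      (λ tree → fanCover N , fanCover-isCherryCover N tree , fanCover-cherries N) ,
  λ tree → fanCover N , fanCover-isCherryCover N tree , trans (fanCover-count N) (tree-excess N tree)
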